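{- If $n\in\mathbb{N}$ and $k\in\{0,1,\dots,n\}$, then $|B_{n,k}|=(n+1)^{n-1}$.
   Context: A parking preference of length $n$ is a tuple $(a_1,\dots,a_n)\in\{1,\dots,n\}^n$; cars $c_1,\dots,c_n$ arrive in this order, car $c_i$ preferring spot $a_i$. Under the $k$-Naples rule on spots $1,\dots,n$ (west to east), car $c_i$ parks at $a_i$ if it is empty; otherwise it checks the spots $a_i-1,\dots,a_i-k$ lying in $\{1,\dots,n\}$, one at a time in this order, and parks in the first empty one; if all are occupied it parks in the first empty spot among $a_i+1,\dots,n$, failing if there is none. The set $B_{n,k}$ of contained parking functions consists of those $k$-Naples parking functions of length $n$ (preferences under which all cars park with this rule) for which no car ever needs to look back past spot $1$: equivalently, if additional available spots $0,-1,-2,\dots$ are added west of spot $1$ and cars may back up into them under the same rule (checking $a_i-1,\dots,a_i-k$ without the restriction to $\{1,\dots,n\}$), then all $n$ cars still park in spots $1,\dots,n$. -}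

module Defs where

open import Data.Nat using (ℕ; zero; suc; _∸_; _≤ᵇ_)
open import Data.Integer using (ℤ; +_; _-_; _+_; _≤ᵇ_)
import Data.Integer as ℤ
open import Data.Integer.Properties using () renaming (_≟_ to _≟ℤ_)
open import Data.Fin using (Fin; toℕ)
open import Data.Vec using (Vec; toList)
open import Data.List using (List; []; _∷_; _++_; map; filterᵇ)
open import Data.Bool.ListAction using (any; all)
open import Data.Bool using (Bool; true; false; _∧_; not)
open import Data.Maybe using (Maybe; just; nothing)
open import Relation.Nullary.Decidable using (⌊_⌋)

-- Spots are integers; the real lot is 1..n (west to east).  Extra spots
-- 0, -1, -2, ... west of spot 1 are used only in the "contained" check.

occupied : List ℤ → ℤ → Bool
occupied occ s = any (λ t → ⌊ t ≟ℤ s ⌋) occ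

firstEmpty : List ℤ → List ℤ → Maybe ℤ
firstEmpty occ [] = nothing
firstEmpty occ (s ∷ ss) with occupied occ s
... | true  = firstEmpty occ ss
... | false = just s

oneTo : ℕ → List ℕ
oneTo zero    = []
oneTo (suc m) = oneTo m ++ (suc m ∷ [])

backSpots : ℕ → ℕ → List ℤ
backSpots k a = map (λ j → + a - + j) (oneTo k)

forwardSpots : ℕ → ℕ → List ℤ
forwardSpots n a = map (λ j → + (a Data.Nat.+ j)) (oneTo (n ∸ a))

inLot : ℕ → ℤ → Bool
inLot n s = (+ 1 ℤ.≤ᵇ s) ∧ (s ℤ.≤ᵇ + n)

-- Full ordered candidate list for a car preferring spot a under the
-- k-Naples rule on spots 1..n.  If `extended` is true, backward checks
-- are not restricted to {1..n} (extra spots 0,-1,... west of spot 1).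
candidates : Bool → ℕ → ℕ → ℕ → List ℤ
candidates false n k a = + a ∷ (filterᵇ (inLot n) (backSpots k a) ++ forwardSpots n a)
candidates true  n k a = + a ∷ (backSpots k a ++ forwardSpots n a)

runFrom : Bool → ℕ → ℕ → List ℤ → List ℕ → Maybe (List ℤ)
runFrom ext n k occ [] = just occ
runFrom ext n k occ (a ∷ as) with firstEmpty occ (candidates ext n k a)
... | nothing = nothing
... | just s  = runFrom ext n k (s ∷ occ) as

-- preference (a_1,...,a_n) ∈ {1..n}^n, encoded by Fin n (value i ↦ i+1)
prefList : ∀ {n} → Vec (Fin n) n → List ℕ
prefList a = map (λ i → suc (toℕ i)) (toList a)

isNaplesPF : (n k : ℕ) → Vec (Fin n) n → Bool
isNaplesPF n k a with runFrom false n k [] (prefList a)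
... | nothing = false
... | just _  = true

parksInLotExtended : (n k : ℕ) → Vec (Fin n) n → Bool
parksInLotExtended n k a with runFrom true n k [] (prefList a)
... | nothing  = false
... | just occ = all (inLot n) occ

isContained : (n k : ℕ) → Vec (Fin n) n → Bool
isContained n k a = isNaplesPF n k a ∧ parksInLotExtended n k a

module Submission where

open import Defs
open import Data.Nat using (ℕ; suc; _≤_; _^_; _∸_)
open import Data.Fin using (Fin)
open import Data.Vec using (Vec)
open import Data.Bool using (T)
open import Data.Product using (Σ)
open import Function.Bundles using (_↔_)

-- Proof strategy: Pollak's circular argument, adapted to the k-Naples rule.
-- Put the n cars on a circular lot with n + 1 spots 0, 1, …, n, where a car
-- preferring a tries a, then the k spots counter-clockwise from a, then the
-- other n spots clockwise from a.  Every preference q ∈ (Fin (n+1))^n then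
-- parks all cars and leaves exactly one spot empty, emptySpot q.  The rule
-- commutes with rotating the circle, so rotating q rotates emptySpot q; hence
-- (n+1)^n ≅ ZeroEmpty × (n+1), where ZeroEmpty = {q | emptySpot q = 0}, and
-- |ZeroEmpty| = (n+1)^(n-1).  Finally, a ∈ {1..n}^n is a contained k-Naples
-- parking function iff its circular run leaves spot 0 empty: while spot 0 is
-- free, each car takes the same spot on the circle, on the lot 1..n and on
-- the lot extended to the west, and the first car taking spot 0 on the
-- circle fails or takes spot 0 on the extended lot.

open import Data.Nat using (zero; _+_; _*_; _<_; z≤n; s≤s; pred)
import Data.Nat.Properties as ℕ
open import Data.Fin using (zero; suc; toℕ; fromℕ; inject₁; lower₁)
import Data.Fin as Fin
open import Data.Fin.Properties
  using (toℕ-injective; toℕ-fromℕ; inject₁-lower₁; lower₁-inject₁′; toℕ-inject₁-≢;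
         toℕ-inject₁; toℕ-lower₁; toℕ≤pred[n]; toℕ<n; pigeonhole; ¬∀⟶∃¬; *↔×)
open import Data.Fin.Permutation using (↔⇒≡)
open import Data.Integer using (ℤ; +_)
import Data.Integer as ℤ
import Data.Integer.Properties as ℤₚ
open import Data.List using (List; []; _∷_; _++_; map; length; lookup; filterᵇ)
open import Data.List.Properties using (map-++; ++-assoc; ++-identityʳ; map-∘; map-cong; filter-all; filter-++)
open import Data.List.Membership.Propositional using (_∈_; _∉_)
open import Data.List.Membership.Propositional.Properties
  using (∈-lookup; ∈-++⁺ʳ; ∈-++⁺ˡ; ∈-++⁻; ∈-map⁺; ∈-map⁻)
open import Data.List.Relation.Unary.Any using (here; there; index)
open import Data.List.Relation.Unary.Any.Properties using (lookup-index)
import Data.List.Relation.Unary.All as All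
import Data.List.Relation.Unary.All.Properties as All
open import Data.Vec using ([]; _∷_; toList)
import Data.Vec as Vec
import Data.Vec.Properties as Vecₚ
open Vecₚ using (toList-map; length-toList)
open import Data.Bool using (Bool; true; false)
open import Data.Bool.Properties using (T?; T-∧; T-irrelevant)
open import Data.Bool.ListAction using (any; all)
open import Data.Maybe using (Maybe; just; nothing; maybe)
import Data.Maybe as Maybe
open import Data.Empty using (⊥-elim)
open import Data.Unit using (⊤)
open import Data.Sum using (_⊎_; inj₁; inj₂)
open import Data.Product using (_×_; _,_; proj₁; proj₂; ∃; map₂)
open import Data.Product.Function.NonDependent.Propositional using (_×-↔_)
open import Function using (_∘_)
open import Function.Bundles using (Inverse; Equivalence; mk↔ₛ′)
open import Function.Properties.Inverse using (↔-refl; ↔-sym; ↔-trans)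
open import Relation.Nullary using (¬_; Dec; yes; no)
open import Relation.Nullary.Decidable using (⌊_⌋)
open import Relation.Binary.Definitions using (DecidableEquality)
open import Relation.Binary.PropositionalEquality
open import Axiom.UniquenessOfIdentityProofs using (module Decidable⇒UIP)

-- Instantiated at ℤ it is the search used by
-- the parking rule in Defs; instantiated at Fin (suc n) it drives the
-- circular lot.

module FirstFree {A : Set} (_≟_ : DecidableEquality A) where

  isOccupied : List A → A → Bool
  isOccupied occ s = any (λ t → ⌊ t ≟ s ⌋) occ

  firstFree : List A → List A → Maybe A
  firstFree occ [] = nothing
  firstFree occ (s ∷ ss) with isOccupied occ s
  ... | true  = firstFree occ ss
  ... | false = just s

  occupied⇒∈ : ∀ occ s → isOccupied occ s ≡ true → s ∈ occ
  occupied⇒∈ (t ∷ occ) s eq with t ≟ s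
  ... | yes refl = here refl
  ... | no _     = there (occupied⇒∈ occ s eq)

  free⇒∉ : ∀ occ s → isOccupied occ s ≡ false → s ∉ occ
  free⇒∉ (t ∷ occ) s eq s∈ with t ≟ s
  free⇒∉ (t ∷ occ) s () _          | yes _
  free⇒∉ (t ∷ occ) s _  (here s≡t) | no t≢s = t≢s (sym s≡t)
  free⇒∉ (t ∷ occ) s eq (there s∈) | no _   = free⇒∉ occ s eq s∈

  ∉⇒free : ∀ occ s → s ∉ occ → isOccupied occ s ≡ false
  ∉⇒free occ s s∉ with isOccupied occ s in eq
  ... | true  = ⊥-elim (s∉ (occupied⇒∈ occ s eq))
  ... | false = refl

  firstFree-just : ∀ occ xs {s} → firstFree occ xs ≡ just s → s ∉ occ × s ∈ xs
  firstFree-just occ (x ∷ xs) eq with isOccupied occ x in e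
  ... | true  = let s∉ , s∈ = firstFree-just occ xs eq in s∉ , there s∈
  firstFree-just occ (x ∷ xs) refl | false = free⇒∉ occ x e , here refl

  firstFree-nothing : ∀ occ xs → firstFree occ xs ≡ nothing → ∀ {x} → x ∈ xs → x ∈ occ
  firstFree-nothing occ (y ∷ xs) eq x∈ with isOccupied occ y in e | x∈
  ... | true  | here refl = occupied⇒∈ occ y e
  ... | true  | there x∈′ = firstFree-nothing occ xs eq x∈′

  firstFree-++-just : ∀ occ xs ys {s} → firstFree occ xs ≡ just s →
                      firstFree occ (xs ++ ys) ≡ just s
  firstFree-++-just occ (x ∷ xs) ys eq with isOccupied occ x
  ... | true  = firstFree-++-just occ xs ys eq
  ... | false = eq

  firstFree-++-nothing : ∀ occ xs ys → firstFree occ xs ≡ nothing →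
                         firstFree occ (xs ++ ys) ≡ firstFree occ ys
  firstFree-++-nothing occ []       ys eq = refl
  firstFree-++-nothing occ (x ∷ xs) ys eq with isOccupied occ x
  ... | true  = firstFree-++-nothing occ xs ys eq

  firstFree-head : ∀ occ {s} ys → s ∉ occ → firstFree occ (s ∷ ys) ≡ just s
  firstFree-head occ {s} ys s∉ rewrite ∉⇒free occ s s∉ = refl

module FirstFreeMap {A B : Set} (_≟A_ : DecidableEquality A) (_≟B_ : DecidableEquality B)
                    (f : A → B) (f-inj : ∀ {x y} → f x ≡ f y → x ≡ y) where
  open FirstFree _≟A_ using () renaming (isOccupied to occA; firstFree to freeA)
  open FirstFree _≟B_ using () renaming (isOccupied to occB; firstFree to freeB)

  isOccupied-map : ∀ occ s → occB (map f occ) (f s) ≡ occA occ s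
  isOccupied-map []        s = refl
  isOccupied-map (t ∷ occ) s with t ≟A s | f t ≟B f s
  ... | yes _    | yes _   = refl
  ... | yes refl | no ne   = ⊥-elim (ne refl)
  ... | no ne    | yes e   = ⊥-elim (ne (f-inj e))
  ... | no _     | no _    = isOccupied-map occ s

  firstFree-map : ∀ occ xs → freeB (map f occ) (map f xs) ≡ Maybe.map f (freeA occ xs)
  firstFree-map occ []       = refl
  firstFree-map occ (x ∷ xs) rewrite isOccupied-map occ x with occA occ x
  ... | true  = firstFree-map occ xs
  ... | false = refl

iter : {A : Set} → (A → A) → ℕ → A → A
iter f zero    x = x
iter f (suc j) x = f (iter f j x)

iter-comm : {A : Set} (f g : A → A) → (∀ x → f (g x) ≡ g (f x)) →
            ∀ j x → iter f j (g x) ≡ g (iter f j x)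
iter-comm f g comm zero    x = refl
iter-comm f g comm (suc j) x = trans (cong f (iter-comm f g comm j x)) (comm _)

iter-inverse : {A : Set} (f g : A → A) → (∀ x → f (g x) ≡ x) → (∀ x → g (f x) ≡ x) →
               ∀ j x → iter f j (iter g j x) ≡ x
iter-inverse f g fg gf zero    x = refl
iter-inverse f g fg gf (suc j) x = begin
  f (iter f j (g (iter g j x)))   ≡⟨ cong f (iter-comm f g f∘g≡g∘f j _) ⟩
  f (g (iter f j (iter g j x)))   ≡⟨ fg _ ⟩
  iter f j (iter g j x)           ≡⟨ iter-inverse f g fg gf j x ⟩
  x                               ∎
  where
  open ≡-Reasoning
  f∘g≡g∘f : ∀ y → f (g y) ≡ g (f y)
  f∘g≡g∘f y = trans (fg y) (sym (gf y))

module _ {n : ℕ} where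

  next : Fin (suc n) → Fin (suc n)
  next x with n ℕ.≟ toℕ x
  ... | yes _  = zero
  ... | no n≢x = suc (lower₁ x n≢x)

  prev : Fin (suc n) → Fin (suc n)
  prev zero    = fromℕ n
  prev (suc y) = inject₁ y

  prev-next : ∀ x → prev (next x) ≡ x
  prev-next x with n ℕ.≟ toℕ x
  ... | yes n≡x  = toℕ-injective (trans (toℕ-fromℕ n) n≡x)
  ... | no n≢x   = inject₁-lower₁ x n≢x

  next-prev : ∀ x → next (prev x) ≡ x
  next-prev zero with n ℕ.≟ toℕ (fromℕ n)
  ... | yes _  = refl
  ... | no n≢n = ⊥-elim (n≢n (sym (toℕ-fromℕ n)))
  next-prev (suc y) with n ℕ.≟ toℕ (inject₁ y)
  ... | yes n≡y = ⊥-elim (toℕ-inject₁-≢ y n≡y)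
  ... | no n≢y  = cong suc (lower₁-inject₁′ y n≢y)

  next-nowrap : ∀ x → toℕ x < n → toℕ (next x) ≡ suc (toℕ x)
  next-nowrap x x<n with n ℕ.≟ toℕ x
  ... | yes n≡x = ⊥-elim (ℕ.<-irrefl (sym n≡x) x<n)
  ... | no n≢x  = cong suc (toℕ-lower₁ x n≢x)

  next-wrap : ∀ x → toℕ x ≡ n → next x ≡ zero
  next-wrap x x≡n with n ℕ.≟ toℕ x
  ... | yes _  = refl
  ... | no n≢x = ⊥-elim (n≢x (sym x≡n))

  next^ prev^ : ℕ → Fin (suc n) → Fin (suc n)
  next^ = iter next
  prev^ = iter prev

  prev^-next^ : ∀ j x → prev^ j (next^ j x) ≡ x
  prev^-next^ = iter-inverse prev next prev-next next-prev

  next^-prev^ : ∀ j x → next^ j (prev^ j x) ≡ x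
  next^-prev^ = iter-inverse next prev next-prev prev-next

  toℕ-next^ : ∀ x j → toℕ x + j ≤ n → toℕ (next^ j x) ≡ toℕ x + j
  toℕ-next^ x zero    _ = sym (ℕ.+-identityʳ _)
  toℕ-next^ x (suc j) x+j<n = begin
    toℕ (next (next^ j x))  ≡⟨ next-nowrap _ (subst (_< n) (sym ih) x+j<n′) ⟩
    suc (toℕ (next^ j x))   ≡⟨ cong suc ih ⟩
    suc (toℕ x + j)         ≡⟨ ℕ.+-suc (toℕ x) j ⟨
    toℕ x + suc j           ∎
    where
    open ≡-Reasoning
    x+j<n′ : toℕ x + j < n
    x+j<n′ = subst (_≤ n) (ℕ.+-suc (toℕ x) j) x+j<n
    ih = toℕ-next^ x j (ℕ.<⇒≤ x+j<n′)

  next^-wrap : ∀ x j → toℕ x + j ≡ n → next^ (suc j) x ≡ zero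
  next^-wrap x j x+j≡n = next-wrap _ (trans (toℕ-next^ x j (ℕ.≤-reflexive x+j≡n)) x+j≡n)

  toℕ-prev^ : ∀ x j → j ≤ toℕ x → toℕ (prev^ j x) ≡ toℕ x ∸ j
  toℕ-prev^ x zero    _ = refl
  toℕ-prev^ x (suc j) j<x with prev^ j x | toℕ-prev^ x j (ℕ.<⇒≤ j<x)
  ... | zero  | ih = ⊥-elim (ℕ.<-irrefl ih (ℕ.m<n⇒0<n∸m j<x))
  ... | suc y | ih = trans (toℕ-inject₁ y) (trans (cong pred ih) (ℕ.pred[m∸n]≡m∸[1+n] (toℕ x) j))

  prev^-to-zero : ∀ x → prev^ (toℕ x) x ≡ zero
  prev^-to-zero x = toℕ-injective (trans (toℕ-prev^ x (toℕ x) ℕ.≤-refl) (ℕ.n∸n≡0 (toℕ x)))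

  next^-from-zero : ∀ b → next^ (toℕ b) zero ≡ b
  next^-from-zero b = toℕ-injective (toℕ-next^ zero (toℕ b) (toℕ≤pred[n] b))

  next^-cover : ∀ a b → ∃ λ j → j ≤ n × next^ j a ≡ b
  next^-cover a b = subst (λ a → ∃ λ j → j ≤ n × next^ j a ≡ b) (next^-from-zero a) (go (toℕ a) b)
    where
    go : ∀ i b → ∃ λ j → j ≤ n × next^ j (next^ i zero) ≡ b
    go zero    b = toℕ b , toℕ≤pred[n] b , next^-from-zero b
    go (suc i) b with go i (prev b)
    ... | j , j≤n , eq = j , j≤n ,
      trans (iter-comm next next (λ _ → refl) j _) (trans (cong next eq) (next-prev b))

Distinct : {A : Set} → List A → Set
Distinct []       = ⊤
Distinct (x ∷ xs) = x ∉ xs × Distinct xs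

lookup-injective : {A : Set} (xs : List A) → Distinct xs →
                   ∀ i j → lookup xs i ≡ lookup xs j → i ≡ j
lookup-injective (x ∷ xs) _          zero    zero    _ = refl
lookup-injective (x ∷ xs) (x∉ , _)   zero    (suc j) e = ⊥-elim (x∉ (subst (_∈ xs) (sym e) (∈-lookup j)))
lookup-injective (x ∷ xs) (x∉ , _)   (suc i) zero    e = ⊥-elim (x∉ (subst (_∈ xs) e (∈-lookup i)))
lookup-injective (x ∷ xs) (_ , dxs)  (suc i) (suc j) e = cong suc (lookup-injective xs dxs i j e)

distinct-length : ∀ {N} (xs : List (Fin N)) → Distinct xs → length xs ≤ N
distinct-length {N} xs dxs with length xs ℕ.≤? N
... | yes ≤N = ≤N
... | no ≰N with pigeonhole (ℕ.≰⇒> ≰N) (lookup xs)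
... | i , j , i<j , eq = ⊥-elim (ℕ.<⇒≢ i<j (cong toℕ (lookup-injective xs dxs i j eq)))

complete-length : ∀ {N} (xs : List (Fin N)) → (∀ b → b ∈ xs) → N ≤ length xs
complete-length {N} xs all∈ with N ℕ.≤? length xs
... | yes N≤ = N≤
... | no N≰ with pigeonhole (ℕ.≰⇒> N≰) (λ b → index (all∈ b))
... | i , j , i<j , eq = ⊥-elim (ℕ.<⇒≢ i<j (cong toℕ (begin
  i                           ≡⟨ lookup-index (all∈ i) ⟩
  lookup xs (index (all∈ i))  ≡⟨ cong (lookup xs) eq ⟩
  lookup xs (index (all∈ j))  ≡⟨ lookup-index (all∈ j) ⟨
  j                           ∎)))
  where open ≡-Reasoning

subtype-≡ : {A : Set} {P : A → Set} → (∀ {a} (p q : P a) → p ≡ q) →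
            ∀ {a b} {p : P a} {q : P b} → a ≡ b → (a , p) ≡ (b , q)
subtype-≡ irr {p = p} {q} refl = cong (_ ,_) (irr p q)

Fin-irrelevant : ∀ {m} {a b : Fin m} (p q : a ≡ b) → p ≡ q
Fin-irrelevant = Decidable⇒UIP.≡-irrelevant Fin._≟_

Vec↔Fin^ : ∀ m l → Vec (Fin m) l ↔ Fin (m ^ l)
Vec↔Fin^ m zero    = mk↔ₛ′ (λ _ → zero) (λ _ → []) (λ { zero → refl }) (λ { [] → refl })
Vec↔Fin^ m (suc l) = ↔-trans head-tail (↔-sym *↔×)
  where
  open Inverse (Vec↔Fin^ m l)
  head-tail : Vec (Fin m) (suc l) ↔ (Fin m × Fin (m ^ l))
  head-tail = mk↔ₛ′ (λ { (x ∷ xs) → x , to xs }) (λ { (x , y) → x ∷ from y })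
                    (λ { (x , y) → cong (x ,_) (strictlyInverseˡ y) })
                    (λ { (x ∷ xs) → cong (x ∷_) (strictlyInverseʳ xs) })

decSubset-finite : ∀ m (P : Fin m → Set) → (∀ x → Dec (P x)) → (∀ {x} (p q : P x) → p ≡ q) →
                   ∃ λ d → Σ (Fin m) P ↔ Fin d
decSubset-finite zero    P P? irr = 0 , mk↔ₛ′ (λ { (() , _) }) (λ ()) (λ ()) (λ { (() , _) })
decSubset-finite (suc m) P P? irr with decSubset-finite m (P ∘ suc) (P? ∘ suc) irr | P? zero
... | d , φ | yes p0 = suc d , mk↔ₛ′ to from to∘from from∘to
  where
  open Inverse φ using () renaming (to to φ-to; from to φ-from)
  to : Σ (Fin (suc m)) P → Fin (suc d)
  to (zero  , _)  = zero
  to (suc x , px) = suc (φ-to (x , px))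
  from : Fin (suc d) → Σ (Fin (suc m)) P
  from zero    = zero , p0
  from (suc y) = suc (proj₁ (φ-from y)) , proj₂ (φ-from y)
  to∘from : ∀ y → to (from y) ≡ y
  to∘from zero    = refl
  to∘from (suc y) = cong suc (Inverse.strictlyInverseˡ φ y)
  from∘to : ∀ x → from (to x) ≡ x
  from∘to (zero  , p)  = subtype-≡ irr refl
  from∘to (suc x , px) = subtype-≡ irr (cong (suc ∘ proj₁) (Inverse.strictlyInverseʳ φ (x , px)))
... | d , φ | no ¬p0 = d , mk↔ₛ′ to from (Inverse.strictlyInverseˡ φ) from∘to
  where
  to : Σ (Fin (suc m)) P → Fin d
  to (zero  , p0) = ⊥-elim (¬p0 p0)
  to (suc x , px) = Inverse.to φ (x , px)
  from : Fin d → Σ (Fin (suc m)) P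
  from y = suc (proj₁ (Inverse.from φ y)) , proj₂ (Inverse.from φ y)
  from∘to : ∀ x → from (to x) ≡ x
  from∘to (zero  , p0) = ⊥-elim (¬p0 p0)
  from∘to (suc x , px) = subtype-≡ irr (cong (suc ∘ proj₁) (Inverse.strictlyInverseʳ φ (x , px)))

Σ-transport : {A B : Set} (φ : A ↔ B) (P : A → Set) → (∀ {a} (p q : P a) → p ≡ q) →
              Σ A P ↔ Σ B (P ∘ Inverse.from φ)
Σ-transport φ P irr = mk↔ₛ′
  (λ { (a , p) → to a , subst P (sym (strictlyInverseʳ a)) p })
  (λ { (b , p) → from b , p })
  (λ { (b , p) → subtype-≡ irr (strictlyInverseˡ b) })
  (λ { (a , p) → subtype-≡ irr (strictlyInverseʳ a) })
  where open Inverse φ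

cancel-factor : ∀ n d → d * suc n ≡ suc n ^ n → d ≡ suc n ^ (n ∸ 1)
cancel-factor zero    d eq = trans (sym (ℕ.*-identityʳ d)) eq
cancel-factor (suc n) d eq =
  ℕ.*-cancelʳ-≡ d _ (suc (suc n)) (trans eq (ℕ.*-comm (suc (suc n)) (suc (suc n) ^ n)))

cardinality-by-orbits : ∀ n (C : Set) → (∃ λ d → C ↔ Fin d) →
                        (C × Fin (suc n)) ↔ Fin (suc n ^ n) → C ↔ Fin (suc n ^ (n ∸ 1))
cardinality-by-orbits n C (d , C↔d) orbits =
  subst (λ m → C ↔ Fin m) (cancel-factor n d (↔⇒≡ d·N↔N^n)) C↔d
  where
  d·N↔N^n : Fin (d * suc n) ↔ Fin (suc n ^ n)
  d·N↔N^n = ↔-trans *↔× (↔-trans (↔-sym C↔d ×-↔ ↔-refl) orbits)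

∈-oneTo : ∀ m {j} → 1 ≤ j → j ≤ m → j ∈ oneTo m
∈-oneTo zero    1≤j j≤0 = ⊥-elim (ℕ.<-irrefl refl (ℕ.≤-trans 1≤j j≤0))
∈-oneTo (suc m) {j} 1≤j j≤m with j ℕ.≟ suc m
... | yes refl = ∈-++⁺ʳ (oneTo m) (here refl)
... | no j≢m   = ∈-++⁺ˡ (∈-oneTo m 1≤j (ℕ.≤-pred (ℕ.≤∧≢⇒< j≤m j≢m)))

oneTo-bounds : ∀ m {j} → j ∈ oneTo m → 1 ≤ j × j ≤ m
oneTo-bounds (suc m) j∈ with ∈-++⁻ (oneTo m) j∈
... | inj₁ j∈′        = let 1≤j , j≤m = oneTo-bounds m j∈′ in 1≤j , ℕ.m≤n⇒m≤1+n j≤m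
... | inj₂ (here refl) = s≤s z≤n , ℕ.≤-refl

map-oneTo-cong : {A : Set} (m : ℕ) (f g : ℕ → A) → (∀ j → 1 ≤ j → j ≤ m → f j ≡ g j) →
                 map f (oneTo m) ≡ map g (oneTo m)
map-oneTo-cong zero    f g f≗g = refl
map-oneTo-cong (suc m) f g f≗g = begin
  map f (oneTo m ++ suc m ∷ [])        ≡⟨ map-++ f (oneTo m) _ ⟩
  map f (oneTo m) ++ f (suc m) ∷ []    ≡⟨ cong₂ (λ xs y → xs ++ y ∷ [])
                                            (map-oneTo-cong m f g λ j 1≤j j≤m → f≗g j 1≤j (ℕ.m≤n⇒m≤1+n j≤m))
                                            (f≗g (suc m) (s≤s z≤n) ℕ.≤-refl) ⟩
  map g (oneTo m) ++ g (suc m) ∷ []    ≡⟨ map-++ g (oneTo m) _ ⟨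
  map g (oneTo m ++ suc m ∷ [])        ∎
  where open ≡-Reasoning

oneTo-+ : ∀ m l → oneTo (m + l) ≡ oneTo m ++ map (_+_ m) (oneTo l)
oneTo-+ m zero    = trans (cong oneTo (ℕ.+-identityʳ m)) (sym (++-identityʳ (oneTo m)))
oneTo-+ m (suc l) = begin
  oneTo (m + suc l)
    ≡⟨ cong oneTo (ℕ.+-suc m l) ⟩
  oneTo (m + l) ++ suc (m + l) ∷ []
    ≡⟨ cong (_++ suc (m + l) ∷ []) (oneTo-+ m l) ⟩
  (oneTo m ++ map (_+_ m) (oneTo l)) ++ suc (m + l) ∷ []
    ≡⟨ ++-assoc (oneTo m) _ _ ⟩
  oneTo m ++ (map (_+_ m) (oneTo l) ++ suc (m + l) ∷ [])
    ≡⟨ cong (λ z → oneTo m ++ (map (_+_ m) (oneTo l) ++ z ∷ [])) (ℕ.+-suc m l) ⟨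
  oneTo m ++ (map (_+_ m) (oneTo l) ++ map (_+_ m) (suc l ∷ []))
    ≡⟨ cong (oneTo m ++_) (map-++ (_+_ m) (oneTo l) _) ⟨
  oneTo m ++ map (_+_ m) (oneTo (suc l))
    ∎
  where open ≡-Reasoning

map-oneTo-split : {A : Set} (f : ℕ → A) (m l : ℕ) {z : A} → f (suc m) ≡ z →
  map f (oneTo (m + suc l)) ≡ map f (oneTo m) ++ z ∷ map (f ∘ (_+_ (suc m))) (oneTo l)
map-oneTo-split f m l {z} f[1+m]≡z = begin
  map f (oneTo (m + suc l))
    ≡⟨ cong (map f) (oneTo-+ m (suc l)) ⟩
  map f (oneTo m ++ map (_+_ m) (oneTo (1 + l)))
    ≡⟨ cong (λ z → map f (oneTo m ++ map (_+_ m) z)) (oneTo-+ 1 l) ⟩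
  map f (oneTo m ++ map (_+_ m) (1 ∷ map suc (oneTo l)))
    ≡⟨ map-++ f (oneTo m) _ ⟩
  map f (oneTo m) ++ f (m + 1) ∷ map f (map (_+_ m) (map suc (oneTo l)))
    ≡⟨ cong₂ (λ x ys → map f (oneTo m) ++ x ∷ ys) middle≡ tail≡ ⟩
  map f (oneTo m) ++ z ∷ map (f ∘ (_+_ (suc m))) (oneTo l)
    ∎
  where
  open ≡-Reasoning
  middle≡ : f (m + 1) ≡ z
  middle≡ = trans (cong f (ℕ.+-comm m 1)) f[1+m]≡z
  tail≡ : map f (map (_+_ m) (map suc (oneTo l))) ≡ map (f ∘ (_+_ (suc m))) (oneTo l)
  tail≡ = trans (sym (map-∘ (map suc (oneTo l))))
                (trans (sym (map-∘ (oneTo l))) (map-cong (λ j → cong f (ℕ.+-suc m j)) (oneTo l)))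

-- A car preferring a tries a,
-- then the k spots counter-clockwise from a, then the n other spots
-- clockwise from a; since this last sweep covers the whole circle, every
-- car parks as long as a spot is free.

module Circle (n k : ℕ) where

  N : ℕ
  N = suc n

  Spot : Set
  Spot = Fin N

  open FirstFree (Fin._≟_ {N}) public
  open import Data.List.Membership.DecPropositional (Fin._≟_ {N}) using (_∈?_)

  back forth : ℕ → Spot → List Spot
  back  m a = map (λ j → prev^ j a) (oneTo m)
  forth m a = map (λ j → next^ j a) (oneTo m)

  circCandidates : Spot → List Spot
  circCandidates a = a ∷ (back k a ++ forth n a)

  park : List Spot → Spot → List Spot
  park occ a = maybe (_∷ occ) occ (firstFree occ (circCandidates a))

  parkAll : List Spot → List Spot → List Spot
  parkAll occ []       = occ
  parkAll occ (a ∷ as) = parkAll (park occ a) as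

  circCandidates-complete : ∀ a b → b ∈ circCandidates a
  circCandidates-complete a b with next^-cover a b
  ... | zero  , _   , refl = here refl
  ... | suc j , 1+j≤n , refl =
    there (∈-++⁺ʳ (back k a) (∈-map⁺ (λ j → next^ j a) (∈-oneTo n (s≤s z≤n) 1+j≤n)))

  park-⊇ : ∀ occ a {s} → s ∈ occ → s ∈ park occ a
  park-⊇ occ a s∈ with firstFree occ (circCandidates a)
  ... | just _  = there s∈
  ... | nothing = s∈

  parkAll-⊇ : ∀ occ as {s} → s ∈ occ → s ∈ parkAll occ as
  parkAll-⊇ occ []       s∈ = s∈
  parkAll-⊇ occ (a ∷ as) s∈ = parkAll-⊇ (park occ a) as (park-⊇ occ a s∈)

  park-preferred : ∀ occ a → a ∈ park occ a
  park-preferred occ a = by-occupancy (isOccupied occ a) refl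
    where
    by-occupancy : ∀ b → isOccupied occ a ≡ b → a ∈ park occ a
    by-occupancy true  e = park-⊇ occ a (occupied⇒∈ occ a e)
    by-occupancy false e rewrite firstFree-head occ (back k a ++ forth n a) (free⇒∉ occ a e) = here refl

  parkAll-preferred : ∀ occ as {a} → a ∈ as → a ∈ parkAll occ as
  parkAll-preferred occ (b ∷ as) (here refl) = parkAll-⊇ (park occ b) as (park-preferred occ b)
  parkAll-preferred occ (b ∷ as) (there a∈)  = parkAll-preferred (park occ b) as a∈

  park-distinct : ∀ occ a → Distinct occ → Distinct (park occ a)
  park-distinct occ a d with firstFree occ (circCandidates a) in e
  ... | just s  = proj₁ (firstFree-just occ (circCandidates a) e) , d
  ... | nothing = d

  parkAll-distinct : ∀ occ as → Distinct occ → Distinct (parkAll occ as)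
  parkAll-distinct occ []       d = d
  parkAll-distinct occ (a ∷ as) d = parkAll-distinct (park occ a) as (park-distinct occ a d)

  park-length : ∀ occ a → length occ < N → length (park occ a) ≡ suc (length occ)
  park-length occ a occ<N with firstFree occ (circCandidates a) in e
  ... | just s  = refl
  ... | nothing = ⊥-elim (ℕ.<⇒≱ occ<N (complete-length occ
                    (λ b → firstFree-nothing occ (circCandidates a) e (circCandidates-complete a b))))

  parkAll-length : ∀ occ as → length occ + length as ≤ n →
                   length (parkAll occ as) ≡ length occ + length as
  parkAll-length occ []       _  = sym (ℕ.+-identityʳ _)
  parkAll-length occ (a ∷ as) ≤n = begin
    length (parkAll (park occ a) as)     ≡⟨ parkAll-length (park occ a) as
                                              (subst (λ l → l + length as ≤ n) (sym grows) ≤n′) ⟩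
    length (park occ a) + length as      ≡⟨ cong (_+ length as) grows ⟩
    suc (length occ) + length as         ≡⟨ ℕ.+-suc (length occ) (length as) ⟨
    length occ + length (a ∷ as)         ∎
    where
    open ≡-Reasoning
    ≤n′ : suc (length occ) + length as ≤ n
    ≤n′ = subst (_≤ n) (ℕ.+-suc (length occ) (length as)) ≤n
    grows : length (park occ a) ≡ suc (length occ)
    grows = park-length occ a (s≤s (ℕ.≤-trans (ℕ.m≤m+n (length occ) (length (a ∷ as))) ≤n))

  Rotational : (Spot → Spot) → Set
  Rotational f = ∀ x → f (next x) ≡ next (f x)

  rotational-prev : ∀ f → Rotational f → ∀ x → prev (f x) ≡ f (prev x)
  rotational-prev f f-rot x = begin
    prev (f x)                 ≡⟨ cong (prev ∘ f) (next-prev x) ⟨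
    prev (f (next (prev x)))   ≡⟨ cong prev (f-rot (prev x)) ⟩
    prev (next (f (prev x)))   ≡⟨ prev-next _ ⟩
    f (prev x)                 ∎
    where open ≡-Reasoning

  circCandidates-map : ∀ f → Rotational f → ∀ a → circCandidates (f a) ≡ map f (circCandidates a)
  circCandidates-map f f-rot a = cong (f a ∷_) (begin
    back k (f a) ++ forth n (f a)
      ≡⟨ cong₂ _++_ (map-cong (λ j → iter-comm prev f (rotational-prev f f-rot) j a) (oneTo k))
                    (map-cong (λ j → iter-comm next f (λ x → sym (f-rot x)) j a) (oneTo n)) ⟩
    map (f ∘ (λ j → prev^ j a)) (oneTo k) ++ map (f ∘ (λ j → next^ j a)) (oneTo n)
      ≡⟨ cong₂ _++_ (map-∘ (oneTo k)) (map-∘ (oneTo n)) ⟩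
    map f (back k a) ++ map f (forth n a)
      ≡⟨ map-++ f (back k a) (forth n a) ⟨
    map f (back k a ++ forth n a) ∎)
    where open ≡-Reasoning

  next^-rotational : ∀ r → Rotational (next^ r)
  next^-rotational r x = iter-comm next next (λ _ → refl) r x

  prev^-rotational : ∀ r → Rotational (prev^ r)
  prev^-rotational r x = iter-comm prev next (λ y → trans (prev-next y) (sym (next-prev y))) r x

  module Renaming (f : Spot → Spot) (f-inj : ∀ {x y} → f x ≡ f y → x ≡ y) (f-rot : Rotational f) where
    open FirstFreeMap (Fin._≟_ {N}) (Fin._≟_ {N}) f f-inj

    park-map : ∀ occ a → park (map f occ) (f a) ≡ map f (park occ a)
    park-map occ a = begin
      maybe (_∷ map f occ) (map f occ) (firstFree (map f occ) (circCandidates (f a)))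
        ≡⟨ cong (maybe (_∷ map f occ) (map f occ) ∘ firstFree (map f occ)) (circCandidates-map f f-rot a) ⟩
      maybe (_∷ map f occ) (map f occ) (firstFree (map f occ) (map f (circCandidates a)))
        ≡⟨ cong (maybe (_∷ map f occ) (map f occ)) (firstFree-map occ (circCandidates a)) ⟩
      maybe (_∷ map f occ) (map f occ) (Maybe.map f (firstFree occ (circCandidates a)))
        ≡⟨ maybe-map (firstFree occ (circCandidates a)) ⟩
      map f (park occ a) ∎
      where
      open ≡-Reasoning
      maybe-map : ∀ m → maybe (_∷ map f occ) (map f occ) (Maybe.map f m) ≡ map f (maybe (_∷ occ) occ m)
      maybe-map (just s) = refl
      maybe-map nothing  = refl

    parkAll-map : ∀ occ as → parkAll (map f occ) (map f as) ≡ map f (parkAll occ as)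
    parkAll-map occ []       = refl
    parkAll-map occ (a ∷ as) rewrite park-map occ a = parkAll-map (park occ a) as

  circRun : Vec Spot n → List Spot
  circRun q = parkAll [] (toList q)

  circRun-length : ∀ q → length (circRun q) ≡ n
  circRun-length q =
    trans (parkAll-length [] (toList q) (ℕ.≤-reflexive (length-toList q))) (length-toList q)

  -- n distinct occupied spots among n + 1: one is empty, and only one.
  empty-exists : ∀ q → ∃ λ x → x ∉ circRun q
  empty-exists q = ¬∀⟶∃¬ N (_∈ circRun q) (_∈? circRun q) λ all∈ →
    ℕ.<-irrefl refl (ℕ.≤-trans (complete-length (circRun q) all∈) (ℕ.≤-reflexive (circRun-length q)))

  empty-unique : ∀ q {x y} → x ∉ circRun q → y ∉ circRun q → x ≡ y
  empty-unique q {x} {y} x∉ y∉ with x Fin.≟ y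
  ... | yes x≡y = x≡y
  ... | no x≢y  = ⊥-elim (ℕ.<-irrefl refl (subst (λ l → suc (suc l) ≤ N) (circRun-length q)
        (distinct-length (x ∷ y ∷ circRun q) (x∉y∷run , y∉ , parkAll-distinct [] (toList q) _))))
    where
    x∉y∷run : x ∉ y ∷ circRun q
    x∉y∷run (here x≡y)  = x≢y x≡y
    x∉y∷run (there x∈) = x∉ x∈

  emptySpot : Vec Spot n → Spot
  emptySpot q = proj₁ (empty-exists q)

  emptySpot-∉ : ∀ q → emptySpot q ∉ circRun q
  emptySpot-∉ q = proj₂ (empty-exists q)

  emptySpot-unique : ∀ q {x} → x ∉ circRun q → x ≡ emptySpot q
  emptySpot-unique q x∉ = empty-unique q x∉ (emptySpot-∉ q)

  module _ (f : Spot → Spot) (f-inj : ∀ {x y} → f x ≡ f y → x ≡ y) (f-rot : Rotational f) where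
    open Renaming f f-inj f-rot

    emptySpot-map : ∀ q → emptySpot (Vec.map f q) ≡ f (emptySpot q)
    emptySpot-map q = sym (emptySpot-unique (Vec.map f q) f[e]∉)
      where
      run-map : circRun (Vec.map f q) ≡ map f (circRun q)
      run-map = trans (cong (parkAll []) (toList-map f q)) (parkAll-map [] (toList q))
      f[e]∉ : f (emptySpot q) ∉ circRun (Vec.map f q)
      f[e]∉ f[e]∈ with ∈-map⁻ f (subst (f (emptySpot q) ∈_) run-map f[e]∈)
      ... | x , x∈ , f[e]≡f[x] = emptySpot-∉ q (subst (_∈ circRun q) (sym (f-inj f[e]≡f[x])) x∈)

  emptySpot-next^ : ∀ r q → emptySpot (Vec.map (next^ r) q) ≡ next^ r (emptySpot q)
  emptySpot-next^ r = emptySpot-map (next^ r) next^-injective (next^-rotational r)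
    where
    next^-injective : ∀ {x y} → next^ r x ≡ next^ r y → x ≡ y
    next^-injective {x} {y} e = trans (sym (prev^-next^ r x)) (trans (cong (prev^ r) e) (prev^-next^ r y))

  emptySpot-prev^ : ∀ r q → emptySpot (Vec.map (prev^ r) q) ≡ prev^ r (emptySpot q)
  emptySpot-prev^ r = emptySpot-map (prev^ r) prev^-injective (prev^-rotational r)
    where
    prev^-injective : ∀ {x y} → prev^ r x ≡ prev^ r y → x ≡ y
    prev^-injective {x} {y} e = trans (sym (next^-prev^ r x)) (trans (cong (next^ r) e) (next^-prev^ r y))

  ZeroEmpty : Set
  ZeroEmpty = Σ (Vec Spot n) (λ q → emptySpot q ≡ zero)

  -- q ↦ (q rotated so that its empty spot becomes 0, its empty spot).
  orbits : Vec Spot n ↔ (ZeroEmpty × Spot)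
  orbits = mk↔ₛ′ to from to∘from from∘to
    where
    to : Vec Spot n → ZeroEmpty × Spot
    to q = (Vec.map (prev^ e) q , trans (emptySpot-prev^ e q) (prev^-to-zero (emptySpot q))) , emptySpot q
      where e = toℕ (emptySpot q)
    from : ZeroEmpty × Spot → Vec Spot n
    from ((q , _) , r) = Vec.map (next^ (toℕ r)) q
    map-inverse : ∀ {f g : Spot → Spot} → (∀ x → f (g x) ≡ x) → ∀ q → Vec.map f (Vec.map g q) ≡ q
    map-inverse fg q = trans (sym (Vecₚ.map-∘ _ _ q)) (trans (Vecₚ.map-cong fg q) (Vecₚ.map-id q))
    from∘to : ∀ q → from (to q) ≡ q
    from∘to q = map-inverse (next^-prev^ (toℕ (emptySpot q))) q
    to∘from : ∀ y → to (from y) ≡ y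
    to∘from ((q , e≡0) , r) = cong₂ _,_ (subtype-≡ Fin-irrelevant (begin
      Vec.map (prev^ (toℕ (emptySpot q′))) q′   ≡⟨ cong (λ e → Vec.map (prev^ (toℕ e)) q′) e′≡r ⟩
      Vec.map (prev^ (toℕ r)) q′                ≡⟨ map-inverse (prev^-next^ (toℕ r)) q ⟩
      q                                         ∎)) e′≡r
      where
      open ≡-Reasoning
      q′ = Vec.map (next^ (toℕ r)) q
      e′≡r : emptySpot q′ ≡ r
      e′≡r = begin
        emptySpot q′                     ≡⟨ emptySpot-next^ (toℕ r) q ⟩
        next^ (toℕ r) (emptySpot q)      ≡⟨ cong (next^ (toℕ r)) e≡0 ⟩
        next^ (toℕ r) zero               ≡⟨ next^-from-zero r ⟩
        r                                ∎

  ZeroEmpty-finite : ∃ λ d → ZeroEmpty ↔ Fin d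
  ZeroEmpty-finite =
    map₂ (↔-trans (Σ-transport (Vec↔Fin^ N n) (λ q → emptySpot q ≡ zero) Fin-irrelevant))
         (decSubset-finite (N ^ n) (λ i → emptySpot (from i) ≡ zero)
                                   (λ i → emptySpot (from i) Fin.≟ zero) Fin-irrelevant)
    where open Inverse (Vec↔Fin^ N n) using (from)

  ZeroEmpty-card : ZeroEmpty ↔ Fin (N ^ (n ∸ 1))
  ZeroEmpty-card =
    cardinality-by-orbits n ZeroEmpty ZeroEmpty-finite (↔-trans (↔-sym orbits) (Vec↔Fin^ N n))

-- Circle spot x is
-- identified with the integer spot ι x, so that the circle spots 1..n are
-- the lot and circle spot 0 is the first extra spot west of the lot.

module Comparison (n k : ℕ) where
  open Circle n k
  module ℤFree = FirstFree ℤ._≟_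
  open ℤFree using () renaming (firstFree to firstFreeℤ)

  ι : Spot → ℤ
  ι x = + toℕ x

  ι-injective : ∀ {x y} → ι x ≡ ι y → x ≡ y
  ι-injective e = toℕ-injective (ℤₚ.+-injective e)

  ι-inLot : ∀ x → x ≢ zero → T (inLot n (ι x))
  ι-inLot zero    0≢0 = ⊥-elim (0≢0 refl)
  ι-inLot (suc y) _   = ℕ.≤⇒≤ᵇ (toℕ<n y)

  firstEmpty≡firstFree : ∀ occ xs → firstEmpty occ xs ≡ firstFreeℤ occ xs
  firstEmpty≡firstFree occ []       = refl
  firstEmpty≡firstFree occ (s ∷ ss) with occupied occ s
  ... | true  = firstEmpty≡firstFree occ ss
  ... | false = refl

  ι-all-inLot : ∀ xs → zero ∉ xs → All.All (T ∘ inLot n) (map ι xs)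
  ι-all-inLot xs 0∉ = All.map⁺ (All.tabulate λ {x} x∈ → ι-inLot x λ { refl → 0∉ x∈ })

  filter-inLot : ∀ xs → zero ∉ xs → filterᵇ (inLot n) (map ι xs) ≡ map ι xs
  filter-inLot xs 0∉ = filter-all (T? ∘ inLot n) (ι-all-inLot xs 0∉)

  nonzero-search : ∀ m (f : ℕ → Spot) → (∀ j → 1 ≤ j → j ≤ m → 1 ≤ toℕ (f j)) →
                   zero ∉ map f (oneTo m)
  nonzero-search m f pos 0∈ with ∈-map⁻ f 0∈
  ... | j , j∈ , 0≡fj = let 1≤j , j≤m = oneTo-bounds m j∈ in
    ℕ.<-irrefl refl (subst (λ x → 1 ≤ toℕ x) (sym 0≡fj) (pos j 1≤j j≤m))

  back-ι : ∀ m a → m ≤ toℕ a → map ι (back m a) ≡ backSpots m (toℕ a)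
  back-ι m a m≤a = trans (sym (map-∘ (oneTo m))) (map-oneTo-cong m _ _ λ j _ j≤m →
    let j≤a = ℕ.≤-trans j≤m m≤a in
    trans (cong +_ (toℕ-prev^ a j j≤a)) (sym (trans (ℤₚ.m-n≡m⊖n (toℕ a) j) (ℤₚ.⊖-≥ j≤a))))

  back-nonzero : ∀ m a → m < toℕ a → zero ∉ back m a
  back-nonzero m a m<a = nonzero-search m _ λ j _ j≤m →
    let j<a = ℕ.≤-<-trans j≤m m<a in subst (1 ≤_) (sym (toℕ-prev^ a j (ℕ.<⇒≤ j<a))) (ℕ.m<n⇒0<n∸m j<a)

  forth-ι : ∀ a → map ι (forth (n ∸ toℕ a) a) ≡ forwardSpots n (toℕ a)
  forth-ι a = trans (sym (map-∘ (oneTo (n ∸ toℕ a)))) (map-oneTo-cong (n ∸ toℕ a) _ _ λ j _ j≤d →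
    cong +_ (toℕ-next^ a j (subst (toℕ a + j ≤_) (ℕ.m+[n∸m]≡n (toℕ≤pred[n] a))
                                  (ℕ.+-monoʳ-≤ (toℕ a) j≤d))))

  forth-nonzero : ∀ m a → toℕ a + m ≤ n → zero ∉ forth m a
  forth-nonzero m a a+m≤n = nonzero-search m _ λ j 1≤j j≤m →
    subst (1 ≤_) (sym (toℕ-next^ a j (ℕ.≤-trans (ℕ.+-monoʳ-≤ (toℕ a) j≤m) a+m≤n)))
          (ℕ.≤-trans 1≤j (ℕ.m≤n+m j (toℕ a)))

  -- The candidates of a car preferring spot i + 1, on the circle and on
  -- the two linear lots, agree up to the first time the circle offers
  -- spot 0; at that point the extended lot has nothing left to offer or
  -- offers spot 0 as well.
  record Split (i : Fin n) : Set where
    field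
      L R              : List Spot
      extRest lotRest  : List ℤ
      circ≡            : circCandidates (suc i) ≡ L ++ zero ∷ R
      L-nonzero        : zero ∉ L
      ext≡             : candidates true  n k (suc (toℕ i)) ≡ map ι L ++ extRest
      lot≡             : candidates false n k (suc (toℕ i)) ≡ map ι L ++ lotRest
      extRest-zero     : extRest ≡ [] ⊎ ∃ λ E → extRest ≡ + 0 ∷ E

  -- If k ≤ i the backward search stays in the lot, and the circle reaches
  -- spot 0 only after sweeping clockwise past spot n.
  split-far : ∀ i → k ≤ toℕ i → Split i
  split-far i k≤i = record
    { L = a ∷ (back k a ++ forth d a) ; R = R ; extRest = [] ; lotRest = []
    ; circ≡ = cong (a ∷_) circ≡ ; L-nonzero = L-nonzero
    ; ext≡ = ext≡ ; lot≡ = trans (cong (λ z → + toℕ a ∷ (z ++ forwardSpots n (toℕ a))) filtered) ext≡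
    ; extRest-zero = inj₁ refl }
    where
    open ≡-Reasoning
    a = suc i
    d = n ∸ toℕ a
    R = map ((λ j → next^ j a) ∘ (_+_ (suc d))) (oneTo (toℕ i))
    k≤a = ℕ.m≤n⇒m≤1+n k≤i
    d+a≡n : d + toℕ a ≡ n
    d+a≡n = ℕ.m∸n+n≡m (toℕ<n i)
    ext≡ : candidates true n k (toℕ a) ≡ map ι (a ∷ (back k a ++ forth d a)) ++ []
    ext≡ = cong (+ toℕ a ∷_) (begin
      backSpots k (toℕ a) ++ forwardSpots n (toℕ a)   ≡⟨ cong₂ _++_ (back-ι k a k≤a) (forth-ι a) ⟨
      map ι (back k a) ++ map ι (forth d a)           ≡⟨ map-++ ι (back k a) (forth d a) ⟨
      map ι (back k a ++ forth d a)                   ≡⟨ ++-identityʳ _ ⟨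
      map ι (back k a ++ forth d a) ++ []             ∎)
    filtered : filterᵇ (inLot n) (backSpots k (toℕ a)) ≡ backSpots k (toℕ a)
    filtered = begin
      filterᵇ (inLot n) (backSpots k (toℕ a))    ≡⟨ cong (filterᵇ (inLot n)) (back-ι k a k≤a) ⟨
      filterᵇ (inLot n) (map ι (back k a))       ≡⟨ filter-inLot (back k a) (back-nonzero k a (s≤s k≤i)) ⟩
      map ι (back k a)                           ≡⟨ back-ι k a k≤a ⟩
      backSpots k (toℕ a)                        ∎
    circ≡ : back k a ++ forth n a ≡ (back k a ++ forth d a) ++ zero ∷ R
    circ≡ = begin
      back k a ++ forth n a                    ≡⟨ cong (λ m → back k a ++ forth m a) d+a≡n ⟨
      back k a ++ forth (d + toℕ a) a          ≡⟨ cong (back k a ++_) (map-oneTo-split (λ j → next^ j a) d (toℕ i)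
                                                    (next^-wrap a d (trans (ℕ.+-comm (toℕ a) d) d+a≡n))) ⟩
      back k a ++ (forth d a ++ zero ∷ R)      ≡⟨ ++-assoc (back k a) _ _ ⟨
      (back k a ++ forth d a) ++ zero ∷ R      ∎
    L-nonzero : zero ∉ a ∷ (back k a ++ forth d a)
    L-nonzero (there 0∈) with ∈-++⁻ (back k a) 0∈
    ... | inj₁ 0∈back  = back-nonzero k a (s≤s k≤i) 0∈back
    ... | inj₂ 0∈forth = forth-nonzero d a (ℕ.≤-reflexive (trans (ℕ.+-comm (toℕ a) d) d+a≡n)) 0∈forth

  -- If i < k the backward search runs west past spot 1: the circle then
  -- offers spot 0 right after spot 1, and so does the extended lot.
  split-near : ∀ i → toℕ i < k → Split i
  split-near i i<k = record
    { L = a ∷ back t a ; R = backTail ++ forth n a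
    ; extRest = + 0 ∷ (tailℤ ++ forwardSpots n (toℕ a))
    ; lotRest = filterᵇ (inLot n) (+ 0 ∷ tailℤ) ++ forwardSpots n (toℕ a)
    ; circ≡ = cong (a ∷_) circ≡ ; L-nonzero = λ { (there 0∈) → back-nonzero t a ℕ.≤-refl 0∈ }
    ; ext≡ = cong (+ toℕ a ∷_) (trans (cong (_++ forwardSpots n (toℕ a)) backSpots≡)
                                      (++-assoc (map ι (back t a)) _ _))
    ; lot≡ = cong (+ toℕ a ∷_) (trans (cong (_++ forwardSpots n (toℕ a)) filtered)
                                      (++-assoc (map ι (back t a)) _ _))
    ; extRest-zero = inj₂ (_ , refl) }
    where
    open ≡-Reasoning
    a = suc i
    t = toℕ i
    u = k ∸ toℕ a
    k≡t+[1+u] : k ≡ t + suc u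
    k≡t+[1+u] = trans (sym (ℕ.m+[n∸m]≡n i<k)) (sym (ℕ.+-suc t u))
    step : ℕ → ℤ
    step j = + toℕ a ℤ.- + j
    tailℤ = map (step ∘ (_+_ (toℕ a))) (oneTo u)
    backTail = map ((λ j → prev^ j a) ∘ (_+_ (toℕ a))) (oneTo u)
    backSpots≡ : backSpots k (toℕ a) ≡ map ι (back t a) ++ + 0 ∷ tailℤ
    backSpots≡ = begin
      map step (oneTo k)                     ≡⟨ cong (λ m → map step (oneTo m)) k≡t+[1+u] ⟩
      map step (oneTo (t + suc u))           ≡⟨ map-oneTo-split step t u (ℤₚ.+-inverseʳ (+ toℕ a)) ⟩
      map step (oneTo t) ++ + 0 ∷ tailℤ      ≡⟨ cong (_++ + 0 ∷ tailℤ) (back-ι t a (ℕ.n≤1+n t)) ⟨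
      map ι (back t a) ++ + 0 ∷ tailℤ        ∎
    filtered : filterᵇ (inLot n) (backSpots k (toℕ a)) ≡ map ι (back t a) ++ filterᵇ (inLot n) (+ 0 ∷ tailℤ)
    filtered = begin
      filterᵇ (inLot n) (backSpots k (toℕ a))
        ≡⟨ cong (filterᵇ (inLot n)) backSpots≡ ⟩
      filterᵇ (inLot n) (map ι (back t a) ++ + 0 ∷ tailℤ)
        ≡⟨ filter-++ (T? ∘ inLot n) (map ι (back t a)) _ ⟩
      filterᵇ (inLot n) (map ι (back t a)) ++ filterᵇ (inLot n) (+ 0 ∷ tailℤ)
        ≡⟨ cong (_++ filterᵇ (inLot n) (+ 0 ∷ tailℤ)) (filter-inLot (back t a) (back-nonzero t a ℕ.≤-refl)) ⟩
      map ι (back t a) ++ filterᵇ (inLot n) (+ 0 ∷ tailℤ)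
        ∎
    circ≡ : back k a ++ forth n a ≡ back t a ++ zero ∷ (backTail ++ forth n a)
    circ≡ = begin
      back k a ++ forth n a                       ≡⟨ cong (λ m → back m a ++ forth n a) k≡t+[1+u] ⟩
      back (t + suc u) a ++ forth n a             ≡⟨ cong (_++ forth n a)
                                                       (map-oneTo-split (λ j → prev^ j a) t u (prev^-to-zero a)) ⟩
      (back t a ++ zero ∷ backTail) ++ forth n a  ≡⟨ ++-assoc (back t a) _ _ ⟩
      back t a ++ zero ∷ (backTail ++ forth n a)  ∎

  split : ∀ i → Split i
  split i with k ℕ.≤? toℕ i
  ... | yes k≤i = split-far i k≤i
  ... | no k≰i  = split-near i (ℕ.≰⇒> k≰i)

  open FirstFreeMap (Fin._≟_ {N}) ℤ._≟_ ι ι-injective using (firstFree-map)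

  data CarStep (occ : List Spot) (i : Fin n) : Set where
    same-spot  : ∀ s → s ≢ zero → park occ (suc i) ≡ s ∷ occ →
                 firstEmpty (map ι occ) (candidates true  n k (suc (toℕ i))) ≡ just (ι s) →
                 firstEmpty (map ι occ) (candidates false n k (suc (toℕ i))) ≡ just (ι s) →
                 CarStep occ i
    takes-zero : park occ (suc i) ≡ zero ∷ occ →
                 firstEmpty (map ι occ) (candidates true n k (suc (toℕ i))) ≡ nothing ⊎
                 firstEmpty (map ι occ) (candidates true n k (suc (toℕ i))) ≡ just (+ 0) →
                 CarStep occ i

  car-step : ∀ occ → zero ∉ occ → ∀ i → CarStep occ i
  car-step occ 0∉ i = by-search (firstFree occ L) refl
    where
    open Split (split i)
    occℤ = map ι occ
    linear-search : ∀ b xs → candidates b n k (suc (toℕ i)) ≡ map ι L ++ xs →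
                    firstEmpty occℤ (candidates b n k (suc (toℕ i))) ≡ firstFreeℤ occℤ (map ι L ++ xs)
    linear-search b xs eq =
      trans (firstEmpty≡firstFree occℤ (candidates b n k (suc (toℕ i)))) (cong (firstFreeℤ occℤ) eq)
    L-search : ∀ {r} → firstFree occ L ≡ r → firstFreeℤ occℤ (map ι L) ≡ Maybe.map ι r
    L-search e = trans (firstFree-map occ L) (cong (Maybe.map ι) e)
    by-search : ∀ r → firstFree occ L ≡ r → CarStep occ i
    by-search (just s) e = same-spot s s≢0 parks (same-in-lot true extRest ext≡) (same-in-lot false lotRest lot≡)
      where
      s≢0 : s ≢ zero
      s≢0 refl = L-nonzero (proj₂ (firstFree-just occ L e))
      parks : park occ (suc i) ≡ s ∷ occ
      parks = cong (maybe (_∷ occ) occ)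
                (trans (cong (firstFree occ) circ≡) (firstFree-++-just occ L (zero ∷ R) e))
      same-in-lot : ∀ b xs → candidates b n k (suc (toℕ i)) ≡ map ι L ++ xs →
                    firstEmpty occℤ (candidates b n k (suc (toℕ i))) ≡ just (ι s)
      same-in-lot b xs eq =
        trans (linear-search b xs eq) (ℤFree.firstFree-++-just occℤ (map ι L) xs (L-search e))
    by-search nothing e = takes-zero parks extended
      where
      parks : park occ (suc i) ≡ zero ∷ occ
      parks = cong (maybe (_∷ occ) occ) (trans (cong (firstFree occ) circ≡)
                (trans (firstFree-++-nothing occ L (zero ∷ R) e) (firstFree-head occ R 0∉)))
      after-L : firstEmpty occℤ (candidates true n k (suc (toℕ i))) ≡ firstFreeℤ occℤ extRest
      after-L = trans (linear-search true extRest ext≡)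
                      (ℤFree.firstFree-++-nothing occℤ (map ι L) extRest (L-search e))
      0∉ℤ : + 0 ∉ occℤ
      0∉ℤ 0∈ with ∈-map⁻ ι 0∈
      ... | x , x∈ , 0≡ιx = 0∉ (subst (_∈ occ) (ι-injective (sym 0≡ιx)) x∈)
      extended : firstEmpty occℤ (candidates true n k (suc (toℕ i))) ≡ nothing ⊎
                 firstEmpty occℤ (candidates true n k (suc (toℕ i))) ≡ just (+ 0)
      extended with extRest-zero
      ... | inj₁ rest≡[]        = inj₁ (trans after-L (cong (firstFreeℤ occℤ) rest≡[]))
      ... | inj₂ (E , rest≡0∷E) = inj₂ (trans after-L (trans (cong (firstFreeℤ occℤ) rest≡0∷E)
                                                              (ℤFree.firstFree-head occℤ E 0∉ℤ)))

  runFrom-park : ∀ b occ a as {s} → firstEmpty occ (candidates b n k a) ≡ just s →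
                 runFrom b n k occ (a ∷ as) ≡ runFrom b n k (s ∷ occ) as
  runFrom-park b occ a as e rewrite e = refl

  runFrom-fail : ∀ b occ a as → firstEmpty occ (candidates b n k a) ≡ nothing →
                 runFrom b n k occ (a ∷ as) ≡ nothing
  runFrom-fail b occ a as e rewrite e = refl

  prefs : List (Fin n) → List ℕ
  prefs = map (λ i → suc (toℕ i))

  ∉-extend : ∀ (occ : List Spot) {s} → zero ∉ occ → s ≢ zero → zero ∉ s ∷ occ
  ∉-extend occ 0∉ s≢0 (here 0≡s) = s≢0 (sym 0≡s)
  ∉-extend occ 0∉ s≢0 (there 0∈) = 0∉ 0∈

  runs-agree : ∀ occ → zero ∉ occ → ∀ ps → zero ∉ parkAll occ (map suc ps) →
               runFrom true  n k (map ι occ) (prefs ps) ≡ just (map ι (parkAll occ (map suc ps))) ×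
               runFrom false n k (map ι occ) (prefs ps) ≡ just (map ι (parkAll occ (map suc ps)))
  runs-agree occ 0∉ []       _     = refl , refl
  runs-agree occ 0∉ (i ∷ ps) 0∉run with car-step occ 0∉ i
  ... | same-spot s s≢0 parks ext lot
    rewrite parks
          | runFrom-park true  (map ι occ) _ (prefs ps) ext
          | runFrom-park false (map ι occ) _ (prefs ps) lot
    = runs-agree (s ∷ occ) (∉-extend occ 0∉ s≢0) ps 0∉run
  ... | takes-zero parks _ rewrite parks =
    ⊥-elim (0∉run (parkAll-⊇ (zero ∷ occ) (map suc ps) (here refl)))

  Escapes : Maybe (List ℤ) → Set
  Escapes r = r ≡ nothing ⊎ ∃ λ occ → r ≡ just occ × + 0 ∈ occ

  escapes-persist : ∀ occ as → + 0 ∈ occ → Escapes (runFrom true n k occ as)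
  escapes-persist occ []       0∈ = inj₂ (occ , refl , 0∈)
  escapes-persist occ (a ∷ as) 0∈ with firstEmpty occ (candidates true n k a)
  ... | nothing = inj₁ refl
  ... | just s  = escapes-persist (s ∷ occ) as (there 0∈)

  runs-escape : ∀ occ → zero ∉ occ → ∀ ps → zero ∈ parkAll occ (map suc ps) →
                Escapes (runFrom true n k (map ι occ) (prefs ps))
  runs-escape occ 0∉ []       0∈    = ⊥-elim (0∉ 0∈)
  runs-escape occ 0∉ (i ∷ ps) 0∈run with car-step occ 0∉ i
  ... | same-spot s s≢0 parks ext _ rewrite parks | runFrom-park true (map ι occ) _ (prefs ps) ext
    = runs-escape (s ∷ occ) (∉-extend occ 0∉ s≢0) ps 0∈run
  ... | takes-zero _ (inj₁ fails) rewrite runFrom-fail true (map ι occ) _ (prefs ps) fails = inj₁ refl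
  ... | takes-zero _ (inj₂ takes0) rewrite runFrom-park true (map ι occ) _ (prefs ps) takes0
    = escapes-persist (+ 0 ∷ map ι occ) (prefs ps) (here refl)

module Containment (n k : ℕ) where
  open Circle n k
  open Comparison n k

  circRun-suc : ∀ p → circRun (Vec.map suc p) ≡ parkAll [] (map suc (toList p))
  circRun-suc p = cong (parkAll []) (toList-map suc p)

  naples-if-parks : ∀ p {o} → runFrom false n k [] (prefList p) ≡ just o → T (isNaplesPF n k p)
  naples-if-parks p e rewrite e = _

  extended-if-parks : ∀ p {o} → runFrom true n k [] (prefList p) ≡ just o → T (all (inLot n) o) →
                      T (parksInLotExtended n k p)
  extended-if-parks p e all-in rewrite e = all-in

  not-extended-if-escapes : ∀ p → Escapes (runFrom true n k [] (prefList p)) →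
                            ¬ T (parksInLotExtended n k p)
  not-extended-if-escapes p (inj₁ fails) t rewrite fails = t
  not-extended-if-escapes p (inj₂ (o , ends , 0∈)) t rewrite ends =
    All.lookup (All.all⁺ (inLot n) o t) 0∈

  contained⇒zero-empty : ∀ p → T (isContained n k p) → zero ∉ circRun (Vec.map suc p)
  contained⇒zero-empty p c 0∈ = not-extended-if-escapes p
    (runs-escape [] (λ ()) (toList p) (subst (zero ∈_) (circRun-suc p) 0∈))
    (proj₂ (T-∧ {isNaplesPF n k p} .Equivalence.to c))

  zero-empty⇒contained : ∀ p → zero ∉ circRun (Vec.map suc p) → T (isContained n k p)
  zero-empty⇒contained p 0∉ = T-∧ .Equivalence.from
    (naples-if-parks p on-lot , extended-if-parks p on-extended (All.all⁻ (inLot n) (ι-all-inLot _ 0∉′)))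
    where
    0∉′ = subst (zero ∉_) (circRun-suc p) 0∉
    on-extended = proj₁ (runs-agree [] (λ ()) (toList p) 0∉′)
    on-lot      = proj₂ (runs-agree [] (λ ()) (toList p) 0∉′)

  -- A preference leaving spot 0 empty never prefers spot 0, so it comes
  -- from a preference in {1..n}^n.
  unshift : ∀ {m} (q : Vec Spot m) → zero ∉ toList q → Vec (Fin n) m
  unshift []          _   = []
  unshift (zero  ∷ q) 0∉  = ⊥-elim (0∉ (here refl))
  unshift (suc i ∷ q) 0∉  = i ∷ unshift q (0∉ ∘ there)

  shift-unshift : ∀ {m} (q : Vec Spot m) 0∉ → Vec.map suc (unshift q 0∉) ≡ q
  shift-unshift []          _  = refl
  shift-unshift (zero  ∷ q) 0∉ = ⊥-elim (0∉ (here refl))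
  shift-unshift (suc i ∷ q) 0∉ = cong (suc i ∷_) (shift-unshift q (0∉ ∘ there))

  unshift-shift : ∀ {m} (p : Vec (Fin n) m) 0∉ → unshift (Vec.map suc p) 0∉ ≡ p
  unshift-shift []      _  = refl
  unshift-shift (i ∷ p) 0∉ = cong (i ∷_) (unshift-shift p (0∉ ∘ there))

  zero-not-preferred : ∀ q → emptySpot q ≡ zero → zero ∉ toList q
  zero-not-preferred q e≡0 0∈ =
    emptySpot-∉ q (subst (_∈ circRun q) (sym e≡0) (parkAll-preferred [] (toList q) 0∈))

  contained↔ZeroEmpty : Σ (Vec (Fin n) n) (λ p → T (isContained n k p)) ↔ ZeroEmpty
  contained↔ZeroEmpty = mk↔ₛ′ to from
    (λ { (q , e≡0) → subtype-≡ Fin-irrelevant (shift-unshift q (zero-not-preferred q e≡0)) })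
    (λ { (p , c) → subtype-≡ T-irrelevant (unshift-shift p _) })
    where
    to : Σ (Vec (Fin n) n) (λ p → T (isContained n k p)) → ZeroEmpty
    to (p , c) = Vec.map suc p , sym (emptySpot-unique (Vec.map suc p) (contained⇒zero-empty p c))
    from : ZeroEmpty → Σ (Vec (Fin n) n) (λ p → T (isContained n k p))
    from (q , e≡0) =
      p , zero-empty⇒contained p (subst (λ q → zero ∉ circRun q) (sym (shift-unshift q 0∉q)) 0∉run)
      where
      0∉q = zero-not-preferred q e≡0
      p = unshift q 0∉q
      0∉run : zero ∉ circRun q
      0∉run = subst (_∉ circRun q) e≡0 (emptySpot-∉ q)

-- |B_{n,k}| = (n + 1)^(n - 1); the argument does not need k ≤ n.
lemma3p4 : (n k : ℕ) → k ≤ n →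
    Σ (Vec (Fin n) n) (λ a → T (isContained n k a)) ↔ Fin (suc n ^ (n ∸ 1))
lemma3p4 n k _ = ↔-trans (Containment.contained↔ZeroEmpty n k) (Circle.ZeroEmpty-card n k)
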